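{- Let $p\geq 3$ be a prime and $\mathbb{Z}_p$ the field of integers modulo $p$. Let $F(\mathbb{Z}_p,p)=\{(g_1,\ldots,g_p)\in\mathbb{Z}_p^p : g_i\neq g_j \text{ for } i\neq j\}$ and let $\overline{F}(\mathbb{Z}_p,p)=\langle F(\mathbb{Z}_p,p)\rangle$ be the subgroup of $\mathbb{Z}_p^p$ it generates (a $\mathbb{Z}_p$-vector subspace). Then $\overline{F}(\mathbb{Z}_p,p)$ is isomorphic, as a $\mathbb{Z}_p$-vector space, to $\mathbb{Z}_p^{p-1}=\mathbb{Z}_p\oplus\cdots\oplus\mathbb{Z}_p$. -}

module Defs where

open import Data.Nat using (ℕ; _+_; _*_; _∸_; NonZero)
open import Data.Nat.DivMod using (_mod_)
open import Data.Fin using (Fin; toℕ)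
open import Data.Vec using (Vec; lookup; zipWith; map; replicate)
open import Relation.Binary.PropositionalEquality using (_≡_; _≢_)
open import Data.Product using (Σ)

module _ (p : ℕ) .{{_ : NonZero p}} where

  0ₚ : Fin p
  0ₚ = 0 mod p

  _+ₚ_ : Fin p → Fin p → Fin p
  a +ₚ b = (toℕ a + toℕ b) mod p

  _*ₚ_ : Fin p → Fin p → Fin p
  a *ₚ b = (toℕ a * toℕ b) mod p

  -ₚ_ : Fin p → Fin p
  -ₚ a = (p ∸ toℕ a) mod p

  vzero : ∀ {n} → Vec (Fin p) n
  vzero = replicate _ 0ₚ

  vadd : ∀ {n} → Vec (Fin p) n → Vec (Fin p) n → Vec (Fin p) n
  vadd = zipWith _+ₚ_

  vneg : ∀ {n} → Vec (Fin p) n → Vec (Fin p) n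
  vneg = map -ₚ_

  vscale : ∀ {n} → Fin p → Vec (Fin p) n → Vec (Fin p) n
  vscale c = map (c *ₚ_)

AllDistinct : ∀ {A : Set} {n} → Vec A n → Set
AllDistinct {n = n} v = (i j : Fin n) → i ≢ j → lookup v i ≢ lookup v j

data InFbar (p : ℕ) .{{_ : NonZero p}} : Vec (Fin p) p → Set where
  gen  : ∀ {g} → AllDistinct g → InFbar p g
  zero : InFbar p (vzero p)
  add  : ∀ {u v} → InFbar p u → InFbar p v → InFbar p (vadd p u v)
  neg  : ∀ {u} → InFbar p u → InFbar p (vneg p u)

record LinearIsoOntoFbar (p : ℕ) .{{_ : NonZero p}} (m : ℕ) : Set where
  field
    ψ         : Vec (Fin p) m → Vec (Fin p) p
    additive  : ∀ u v → ψ (vadd p u v) ≡ vadd p (ψ u) (ψ v)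
    homog     : ∀ c u → ψ (vscale p c u) ≡ vscale p c (ψ u)
    injective : ∀ u v → ψ u ≡ ψ v → u ≡ v
    into      : ∀ u → InFbar p (ψ u)
    onto      : ∀ g → InFbar p g → Σ (Vec (Fin p) m) (λ u → ψ u ≡ g)

{-# OPTIONS --safe #-}
-- Reading coordinates in ℕ, the coordinate sum modulo p is a linear form on ℤ_p^p. A vector with
-- pairwise distinct coordinates lists 0, …, p − 1 in some order, so its coordinate sum is
-- p(p − 1)/2, which vanishes modulo an odd p: F̄ lies in the zero-sum hyperplane, and
-- ψ t = (−Σ t) ∷ t is a linear isomorphism from ℤ_p^(p−1) onto that hyperplane. Conversely, with σ
-- the transposition of 1 and i + 1 and τ that of 0 and i + 1, the distinct vectors σ and σ ∘ τ
-- differ by e_(i+1) − e_0 = ψ(e_i), and the ψ(e_i) generate the hyperplane, so F̄ is all of it.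
module Submission where

open import Defs
open import Data.Nat using (ℕ; zero; suc; _+_; _*_; _∸_; _≤_; _<_; NonZero; z≤n; s≤s)
open import Data.Nat.Properties
  using (+-0-commutativeMonoid; +-commutativeSemigroup; +-comm; +-identityʳ; +-assoc; *-zeroʳ;
         *-distribˡ-+; +-cancelʳ-≡; *-cancelˡ-≡; m+[n∸m]≡n; m∸n+n≡m; 1+n≰n; <⇒≤)
open import Data.Nat.DivMod
  using (_%_; _/_; _mod_; %-distribˡ-+; %-distribˡ-*; m%n%n≡m%n; [m+n]%n≡m%n; [m+kn]%n≡m%n; m<n⇒m%n≡m;
         m%n≤n; m%n<n; m≡m%n+[m/n]*n)
open import Data.Nat.Divisibility using (divides)
open import Data.Nat.Primality using (Prime; composite)
open import Data.Nat.Tactic.RingSolver using (solve-∀)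
open import Data.Fin using (Fin; zero; suc; toℕ; inject₁; fromℕ; punchOut; _≟_)
open import Data.Fin.Properties
  using (toℕ<n; toℕ-injective; toℕ-fromℕ<; toℕ-inject₁; toℕ-fromℕ; suc-injective; any?;
         punchOut-injective; injective⇒≤)
open import Data.Fin.Permutation using (Permutation′; permutation)
open import Data.Fin.Permutation.Components using (transpose; transpose-inverse)
open import Data.Vec using (Vec; []; _∷_; lookup; tabulate; tail; _[_]≔_)
open import Data.Vec.Properties
  using (lookup∘tabulate; lookup-zipWith; lookup-map; lookup∘update; lookup∘update′;
         lookup-replicate; tabulate∘lookup; tabulate-cong)
open import Algebra.Properties.CommutativeMonoid.Sum +-0-commutativeMonoid
  using (sum; sum-permute; sum-init-last; sum-cong-≗)
open import Algebra.Properties.CommutativeSemigroup +-commutativeSemigroup using (interchange)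
open import Data.Product using (∃; _,_; proj₁; proj₂)
open import Function using (_∘_)
open import Function.Definitions using (Injective)
open import Level using (0ℓ)
open import Relation.Binary using (Setoid)
open import Relation.Binary.PropositionalEquality
open import Relation.Nullary using (yes; no; contradiction)

allDistinct⇒injective : ∀ {A : Set} {n} (g : Vec A n) → AllDistinct g → Injective _≡_ _≡_ (lookup g)
allDistinct⇒injective g distinct {i} {j} gi≡gj with i ≟ j
... | yes i≡j = i≡j
... | no  i≢j = contradiction gi≡gj (distinct i j i≢j)

injective⇒allDistinct : ∀ {A : Set} {n} {f : Fin n → A} → Injective _≡_ _≡_ f → AllDistinct (tabulate f)
injective⇒allDistinct {f = f} f-injective i j i≢j fi≡fj =
  i≢j (f-injective (trans (sym (lookup∘tabulate f i)) (trans fi≡fj (lookup∘tabulate f j))))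

injective⇒surjective : ∀ {n} {f : Fin n → Fin n} → Injective _≡_ _≡_ f → ∀ y → ∃ λ x → f x ≡ y
injective⇒surjective {suc m} {f} f-injective y with any? (λ x → f x ≟ y)
... | yes hit = hit
... | no miss = contradiction (injective⇒≤ punchOut-y-injective) 1+n≰n
  where
  y≢f : ∀ x → y ≢ f x
  y≢f x y≡fx = miss (x , sym y≡fx)

  punchOut-y-injective : Injective _≡_ _≡_ (λ x → punchOut (y≢f x))
  punchOut-y-injective e = f-injective (punchOut-injective (y≢f _) (y≢f _) e)

injective⇒permutation : ∀ {n} {f : Fin n → Fin n} → Injective _≡_ _≡_ f → Permutation′ n
injective⇒permutation {f = f} f-injective =
  permutation f (proj₁ ∘ onto) (proj₂ ∘ onto) (λ x → f-injective (proj₂ (onto (f x))))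
  where onto = injective⇒surjective f-injective

sum-∘-injective : ∀ {n} (h : Fin n → ℕ) {f : Fin n → Fin n} → Injective _≡_ _≡_ f → sum (h ∘ f) ≡ sum h
sum-∘-injective h f-injective = sym (sum-permute h (injective⇒permutation f-injective))

lookup-extensionality : ∀ {A : Set} {n} {u v : Vec A n} → (∀ i → lookup u i ≡ lookup v i) → u ≡ v
lookup-extensionality {u = u} {v} pointwise =
  trans (sym (tabulate∘lookup u)) (trans (tabulate-cong pointwise) (tabulate∘lookup v))

transpose-matchʳ : ∀ {n} (i j : Fin n) → transpose i j j ≡ i
transpose-matchʳ i j with j ≟ i
... | yes j≡i = j≡i
... | no _ with j ≟ j
...   | yes _ = refl
...   | no j≢j = contradiction refl j≢j

transpose-other : ∀ {n} {i j k : Fin n} → k ≢ i → k ≢ j → transpose i j k ≡ k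
transpose-other {i = i} {j} {k} k≢i k≢j with k ≟ i
... | yes k≡i = contradiction k≡i k≢i
... | no _ with k ≟ j
...   | yes k≡j = contradiction k≡j k≢j
...   | no _ = refl

transpose-injective : ∀ {n} (i j : Fin n) → Injective _≡_ _≡_ (transpose i j)
transpose-injective i j e = trans (sym (transpose-inverse j i)) (trans (cong (transpose j i) e) (transpose-inverse j i))

sum-toℕ : ∀ n → 2 * sum (toℕ {n}) + n ≡ n * n
sum-toℕ zero = refl
sum-toℕ (suc n) = begin
  2 * sum (toℕ {suc n}) + suc n                          ≡⟨ cong (λ s → 2 * s + suc n)
                                                                  (sum-init-last (toℕ {suc n})) ⟩
  2 * (sum (toℕ ∘ inject₁ {n}) + toℕ (fromℕ n)) + suc n  ≡⟨ cong₂ (λ s m → 2 * (s + m) + suc n)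
                                                                  (sum-cong-≗ {n} toℕ-inject₁) (toℕ-fromℕ n) ⟩
  2 * (sum (toℕ {n}) + n) + suc n                        ≡⟨ regroup (sum (toℕ {n})) n ⟩
  (2 * sum (toℕ {n}) + n) + (2 * n + 1)                  ≡⟨ cong (_+ (2 * n + 1)) (sum-toℕ n) ⟩
  n * n + (2 * n + 1)                                    ≡⟨ square-suc n ⟩
  suc n * suc n                                          ∎
  where
  open ≡-Reasoning
  regroup : ∀ s n → 2 * (s + n) + suc n ≡ (2 * s + n) + (2 * n + 1)
  regroup = solve-∀
  square-suc : ∀ n → n * n + (2 * n + 1) ≡ suc n * suc n
  square-suc = solve-∀

sum-toℕ-odd : ∀ q → sum (toℕ {suc (q * 2)}) ≡ q * suc (q * 2)
sum-toℕ-odd q = *-cancelˡ-≡ _ _ 2 (+-cancelʳ-≡ (suc (q * 2)) _ _ (trans (sum-toℕ (suc (q * 2))) (square-odd q)))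
  where
  square-odd : ∀ q → suc (q * 2) * suc (q * 2) ≡ 2 * (q * suc (q * 2)) + suc (q * 2)
  square-odd = solve-∀

prime⇒odd : ∀ {p} → Prime p → 2 < p → ∃ λ q → p ≡ suc (q * 2)
prime⇒odd {p} p-prime 2<p with p % 2 | m≡m%n+[m/n]*n p 2 | m%n<n p 2
... | 0 | p≡2q | _ = contradiction (composite 2<p (divides (p / 2) p≡2q)) (Prime.notComposite p-prime)
... | 1 | p≡1+2q | _ = p / 2 , p≡1+2q
... | suc (suc _) | _ | s≤s (s≤s ())

vsum : ∀ {p m} → Vec (Fin p) m → ℕ
vsum g = sum (toℕ ∘ lookup g)

oddLength-allDistinct⇒vsum : ∀ {p} q → p ≡ suc (q * 2) → (g : Vec (Fin p) p) → AllDistinct g → vsum g ≡ q * p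
oddLength-allDistinct⇒vsum q refl g distinct =
  trans (sum-∘-injective toℕ (allDistinct⇒injective g distinct)) (sum-toℕ-odd q)

module ModularArithmetic (p : ℕ) .{{_ : NonZero p}} where

  -- A record rather than a function, so that m and n can be inferred from m ≈ n.
  infix 4 _≈_
  record _≈_ (m n : ℕ) : Set where
    constructor mk≈
    field %-≡ : m % p ≡ n % p

  ≈-refl : ∀ {m} → m ≈ m
  ≈-refl = mk≈ refl

  ≈-sym : ∀ {m n} → m ≈ n → n ≈ m
  ≈-sym (mk≈ e) = mk≈ (sym e)

  ≈-trans : ∀ {m n o} → m ≈ n → n ≈ o → m ≈ o
  ≈-trans (mk≈ e) (mk≈ f) = mk≈ (trans e f)

  ≈-setoid : Setoid 0ℓ 0ℓ
  ≈-setoid = record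
    { Carrier       = ℕ
    ; _≈_           = _≈_
    ; isEquivalence = record { refl = ≈-refl ; sym = ≈-sym ; trans = ≈-trans }
    }

  open import Relation.Binary.Reasoning.Setoid ≈-setoid

  infixl 6 _⊕_
  _⊕_ : Fin p → Fin p → Fin p
  _⊕_ = _+ₚ_ p

  infix 8 ⊖_
  ⊖_ : Fin p → Fin p
  ⊖_ = -ₚ_ p

  %-≈ : ∀ m → m % p ≈ m
  %-≈ m = mk≈ (m%n%n≡m%n m p)

  +-cong-≈ : ∀ {m n o q} → m ≈ n → o ≈ q → m + o ≈ n + q
  +-cong-≈ {m} {n} {o} {q} (mk≈ m≈n) (mk≈ o≈q) =
    mk≈ (trans (%-distribˡ-+ m o p) (trans (cong₂ (λ a b → (a + b) % p) m≈n o≈q) (sym (%-distribˡ-+ n q p))))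

  *-cong-≈ : ∀ {m n o q} → m ≈ n → o ≈ q → m * o ≈ n * q
  *-cong-≈ {m} {n} {o} {q} (mk≈ m≈n) (mk≈ o≈q) =
    mk≈ (trans (%-distribˡ-* m o p) (trans (cong₂ (λ a b → (a * b) % p) m≈n o≈q) (sym (%-distribˡ-* n q p))))

  p≈0 : p ≈ 0
  p≈0 = mk≈ ([m+n]%n≡m%n 0 p)

  +-inverseʳ-≈ : ∀ m → m + (p ∸ m % p) ≈ 0
  +-inverseʳ-≈ m = begin
    m + (p ∸ m % p)      ≈⟨ +-cong-≈ (%-≈ m) ≈-refl ⟨
    m % p + (p ∸ m % p)  ≡⟨ m+[n∸m]≡n (m%n≤n m p) ⟩
    p                    ≈⟨ p≈0 ⟩
    0                    ∎

  +-cancelʳ-≈ : ∀ {m n} o → m + o ≈ n + o → m ≈ n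
  +-cancelʳ-≈ {m} {n} o m+o≈n+o = begin
    m                ≡⟨ +-identityʳ m ⟨
    m + 0            ≈⟨ +-cong-≈ ≈-refl (+-inverseʳ-≈ o) ⟨
    m + (o + o′)     ≡⟨ +-assoc m o o′ ⟨
    m + o + o′       ≈⟨ +-cong-≈ m+o≈n+o ≈-refl ⟩
    n + o + o′       ≡⟨ +-assoc n o o′ ⟩
    n + (o + o′)     ≈⟨ +-cong-≈ ≈-refl (+-inverseʳ-≈ o) ⟩
    n + 0            ≡⟨ +-identityʳ n ⟩
    n                ∎
    where o′ = p ∸ o % p

  toℕ-injective-≈ : ∀ {x y : Fin p} → toℕ x ≈ toℕ y → x ≡ y
  toℕ-injective-≈ {x} {y} (mk≈ e) =
    toℕ-injective (trans (sym (m<n⇒m%n≡m (toℕ<n x))) (trans e (m<n⇒m%n≡m (toℕ<n y))))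

  toℕ-mod : ∀ m → toℕ (m mod p) ≈ m
  toℕ-mod m = ≈-trans (mk≈ (cong (_% p) (toℕ-fromℕ< _))) (%-≈ m)

  toℕ-⊖ : ∀ x → toℕ (⊖ x) + toℕ x ≈ 0
  toℕ-⊖ x = begin
    toℕ (⊖ x) + toℕ x        ≈⟨ +-cong-≈ (toℕ-mod (p ∸ toℕ x)) ≈-refl ⟩
    p ∸ toℕ x + toℕ x        ≡⟨ m∸n+n≡m (<⇒≤ (toℕ<n x)) ⟩
    p                        ≈⟨ p≈0 ⟩
    0                        ∎

  mod-+ : ∀ m n → (m + n) mod p ≡ m mod p ⊕ n mod p
  mod-+ m n = toℕ-injective-≈ (begin
    toℕ ((m + n) mod p)                 ≈⟨ toℕ-mod (m + n) ⟩
    m + n                               ≈⟨ +-cong-≈ (toℕ-mod m) (toℕ-mod n) ⟨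
    toℕ (m mod p) + toℕ (n mod p)       ≈⟨ toℕ-mod _ ⟨
    toℕ (m mod p ⊕ n mod p)             ∎)

  ⊕-identityˡ : ∀ x → 0ₚ p ⊕ x ≡ x
  ⊕-identityˡ x = toℕ-injective-≈ (begin
    toℕ (0ₚ p ⊕ x)         ≈⟨ toℕ-mod _ ⟩
    toℕ (0ₚ p) + toℕ x     ≈⟨ +-cong-≈ (toℕ-mod 0) ≈-refl ⟩
    toℕ x                  ∎)

  ⊕-identityʳ : ∀ x → x ⊕ 0ₚ p ≡ x
  ⊕-identityʳ x = toℕ-injective-≈ (begin
    toℕ (x ⊕ 0ₚ p)         ≈⟨ toℕ-mod _ ⟩
    toℕ x + toℕ (0ₚ p)     ≈⟨ +-cong-≈ ≈-refl (toℕ-mod 0) ⟩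
    toℕ x + 0              ≡⟨ +-identityʳ (toℕ x) ⟩
    toℕ x                  ∎)

  ⊕-inverseʳ : ∀ x → x ⊕ ⊖ x ≡ 0ₚ p
  ⊕-inverseʳ x = toℕ-injective-≈ (begin
    toℕ (x ⊕ ⊖ x)          ≈⟨ toℕ-mod _ ⟩
    toℕ x + toℕ (⊖ x)      ≡⟨ +-comm (toℕ x) _ ⟩
    toℕ (⊖ x) + toℕ x      ≈⟨ toℕ-⊖ x ⟩
    0                      ≈⟨ toℕ-mod 0 ⟨
    toℕ (0ₚ p)             ∎)

  ⊖-zero : ⊖ 0ₚ p ≡ 0ₚ p
  ⊖-zero = trans (sym (⊕-identityˡ (⊖ 0ₚ p))) (⊕-inverseʳ (0ₚ p))

module VectorSpace (p : ℕ) .{{_ : NonZero p}} where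
  open ModularArithmetic p
  open import Relation.Binary.Reasoning.Setoid ≈-setoid

  vadd-identityˡ : ∀ {m} (u : Vec (Fin p) m) → vadd p (vzero p) u ≡ u
  vadd-identityˡ [] = refl
  vadd-identityˡ (x ∷ u) = cong₂ _∷_ (⊕-identityˡ x) (vadd-identityˡ u)

  unit : ∀ {m} → Fin m → Vec (Fin p) m
  unit i = vzero p [ i ]≔ (1 mod p)

  unit-induction : ∀ {m} (P : Vec (Fin p) m → Set) → P (vzero p) →
                   (∀ {u v} → P u → P v → P (vadd p u v)) → (∀ i → P (unit i)) → ∀ u → P u
  unit-induction P P-zero P-add P-unit [] = P-zero
  -- x ∷ t = (x ∷ 0) + (0 ∷ t): the first summand is a multiple of the first unit vector, the
  -- second is handled by induction on the length.
  unit-induction P P-zero P-add P-unit (x ∷ t) =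
    subst P (cong₂ _∷_ (⊕-identityʳ x) (vadd-identityˡ t)) (P-add (P-head x) P-tail)
    where
    P-tail : P (0ₚ p ∷ t)
    P-tail = unit-induction (λ t → P (0ₚ p ∷ t)) P-zero
               (λ {u} {v} a b → subst (λ z → P (z ∷ vadd p u v)) (⊕-identityʳ (0ₚ p)) (P-add a b))
               (P-unit ∘ suc) t

    P-mod : ∀ c → P (c mod p ∷ vzero p)
    P-mod zero = P-zero
    P-mod (suc c) = subst P (cong₂ _∷_ (sym (mod-+ 1 c)) (vadd-identityˡ (vzero p))) (P-add (P-unit zero) (P-mod c))

    P-head : ∀ x → P (x ∷ vzero p)
    P-head x = subst (λ z → P (z ∷ vzero p)) (toℕ-injective-≈ (toℕ-mod (toℕ x))) (P-mod (toℕ x))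

  -- A record for the same reason: vsum unfolds to a fold that unification cannot invert.
  record ZeroSum {m} (g : Vec (Fin p) m) : Set where
    constructor zeroSum
    field vsum≈0 : vsum g ≈ 0

  vsum-vadd : ∀ {m} (u v : Vec (Fin p) m) → vsum (vadd p u v) ≈ vsum u + vsum v
  vsum-vadd [] [] = ≈-refl
  vsum-vadd (x ∷ u) (y ∷ v) = begin
    toℕ (x ⊕ y) + vsum (vadd p u v)       ≈⟨ +-cong-≈ (toℕ-mod _) (vsum-vadd u v) ⟩
    (toℕ x + toℕ y) + (vsum u + vsum v)   ≡⟨ interchange (toℕ x) (toℕ y) (vsum u) (vsum v) ⟩
    (toℕ x + vsum u) + (toℕ y + vsum v)   ∎

  vsum-vneg : ∀ {m} (u : Vec (Fin p) m) → vsum (vneg p u) + vsum u ≈ 0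
  vsum-vneg [] = ≈-refl
  vsum-vneg (x ∷ u) = begin
    (toℕ (⊖ x) + vsum (vneg p u)) + (toℕ x + vsum u)  ≡⟨ interchange (toℕ (⊖ x)) _ (toℕ x) _ ⟩
    (toℕ (⊖ x) + toℕ x) + (vsum (vneg p u) + vsum u)  ≈⟨ +-cong-≈ (toℕ-⊖ x) (vsum-vneg u) ⟩
    0                                                 ∎

  vsum-vscale : ∀ {m} c (u : Vec (Fin p) m) → vsum (vscale p c u) ≈ toℕ c * vsum u
  vsum-vscale c [] = mk≈ (cong (_% p) (sym (*-zeroʳ (toℕ c))))
  vsum-vscale c (x ∷ u) = begin
    toℕ (_*ₚ_ p c x) + vsum (vscale p c u)   ≈⟨ +-cong-≈ (toℕ-mod _) (vsum-vscale c u) ⟩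
    toℕ c * toℕ x + toℕ c * vsum u           ≡⟨ *-distribˡ-+ (toℕ c) (toℕ x) (vsum u) ⟨
    toℕ c * (toℕ x + vsum u)                 ∎

  zeroSum-vzero : ∀ {m} → ZeroSum (vzero p {m})
  zeroSum-vzero {m} = zeroSum (vsum-vzero m)
    where
    vsum-vzero : ∀ m → vsum (vzero p {m}) ≈ 0
    vsum-vzero zero = ≈-refl
    vsum-vzero (suc m) = +-cong-≈ (toℕ-mod 0) (vsum-vzero m)

  zeroSum-vadd : ∀ {m} {u v : Vec (Fin p) m} → ZeroSum u → ZeroSum v → ZeroSum (vadd p u v)
  zeroSum-vadd {u = u} {v} (zeroSum Σu≈0) (zeroSum Σv≈0) =
    zeroSum (≈-trans (vsum-vadd u v) (+-cong-≈ Σu≈0 Σv≈0))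

  zeroSum-vneg : ∀ {m} {u : Vec (Fin p) m} → ZeroSum u → ZeroSum (vneg p u)
  zeroSum-vneg {u = u} (zeroSum Σu≈0) = zeroSum (begin
    vsum (vneg p u)           ≡⟨ +-identityʳ _ ⟨
    vsum (vneg p u) + 0       ≈⟨ +-cong-≈ ≈-refl Σu≈0 ⟨
    vsum (vneg p u) + vsum u  ≈⟨ vsum-vneg u ⟩
    0                         ∎)

  zeroSum-vscale : ∀ {m} c {u : Vec (Fin p) m} → ZeroSum u → ZeroSum (vscale p c u)
  zeroSum-vscale c {u} (zeroSum Σu≈0) = zeroSum (begin
    vsum (vscale p c u)  ≈⟨ vsum-vscale c u ⟩
    toℕ c * vsum u       ≈⟨ *-cong-≈ (≈-refl {toℕ c}) Σu≈0 ⟩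
    toℕ c * 0            ≡⟨ *-zeroʳ (toℕ c) ⟩
    0                    ∎)

  InFbar⇒zeroSum : (∀ {g : Vec (Fin p) p} → AllDistinct g → ZeroSum g) → ∀ {g} → InFbar p g → ZeroSum g
  InFbar⇒zeroSum zeroSum-gen (gen distinct) = zeroSum-gen distinct
  InFbar⇒zeroSum zeroSum-gen zero = zeroSum-vzero
  InFbar⇒zeroSum zeroSum-gen (add u∈F̄ v∈F̄) =
    zeroSum-vadd (InFbar⇒zeroSum zeroSum-gen u∈F̄) (InFbar⇒zeroSum zeroSum-gen v∈F̄)
  InFbar⇒zeroSum zeroSum-gen (neg u∈F̄) = zeroSum-vneg (InFbar⇒zeroSum zeroSum-gen u∈F̄)

  allDistinct⇒zeroSum : (∃ λ q → p ≡ suc (q * 2)) → ∀ {g : Vec (Fin p) p} → AllDistinct g → ZeroSum g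
  allDistinct⇒zeroSum (q , p-odd) {g} distinct =
    zeroSum (mk≈ (trans (cong (_% p) (oddLength-allDistinct⇒vsum q p-odd g distinct)) ([m+kn]%n≡m%n 0 q p)))

  ψ : ∀ {m} → Vec (Fin p) m → Vec (Fin p) (suc m)
  ψ t = ⊖ (vsum t mod p) ∷ t

  ψ-zeroSum : ∀ {m} (t : Vec (Fin p) m) → ZeroSum (ψ t)
  ψ-zeroSum t = zeroSum (begin
    toℕ (⊖ s) + vsum t  ≈⟨ +-cong-≈ ≈-refl (toℕ-mod (vsum t)) ⟨
    toℕ (⊖ s) + toℕ s   ≈⟨ toℕ-⊖ s ⟩
    0                   ∎)
    where s = vsum t mod p

  ψ∘tail : ∀ {m} (g : Vec (Fin p) (suc m)) → ZeroSum g → ψ (tail g) ≡ g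
  ψ∘tail (x ∷ t) (zeroSum Σg≈0) =
    cong (_∷ t) (toℕ-injective-≈ (+-cancelʳ-≈ (vsum t)
      (≈-trans (ZeroSum.vsum≈0 (ψ-zeroSum t)) (≈-sym Σg≈0))))

  ψ-vzero : ∀ {m} → ψ (vzero p {m}) ≡ vzero p
  ψ-vzero = ψ∘tail (vzero p) zeroSum-vzero

  ψ-vadd : ∀ {m} (u v : Vec (Fin p) m) → ψ (vadd p u v) ≡ vadd p (ψ u) (ψ v)
  ψ-vadd u v = ψ∘tail (vadd p (ψ u) (ψ v)) (zeroSum-vadd (ψ-zeroSum u) (ψ-zeroSum v))

  ψ-vscale : ∀ {m} c (u : Vec (Fin p) m) → ψ (vscale p c u) ≡ vscale p c (ψ u)
  ψ-vscale c u = ψ∘tail (vscale p c (ψ u)) (zeroSum-vscale c (ψ-zeroSum u))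

  ψ-injective : ∀ {m} (u v : Vec (Fin p) m) → ψ u ≡ ψ v → u ≡ v
  ψ-injective u v = cong tail

module Generators (n : ℕ) where
  -- With p a successor of a successor, 0ₚ p and 1 mod p compute to zero and suc zero.
  p : ℕ
  p = suc (suc n)

  open ModularArithmetic p
  open VectorSpace p

  σ τ : Fin (suc n) → Fin p → Fin p
  σ i = transpose (suc zero) (suc i)
  τ i = transpose zero (suc i)

  difference : Fin (suc n) → Vec (Fin p) p
  difference i = vadd p (tabulate (σ i)) (vneg p (tabulate (σ i ∘ τ i)))

  difference∈F̄ : ∀ i → InFbar p (difference i)
  difference∈F̄ i = add (gen (injective⇒allDistinct σ-injective)) (neg (gen (injective⇒allDistinct σ∘τ-injective)))
    where
    σ-injective : Injective _≡_ _≡_ (σ i)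
    σ-injective = transpose-injective (suc zero) (suc i)

    σ∘τ-injective : Injective _≡_ _≡_ (σ i ∘ τ i)
    σ∘τ-injective e = transpose-injective zero (suc i) (σ-injective e)

  lookup-difference : ∀ i x → lookup (difference i) x ≡ σ i x ⊕ ⊖ σ i (τ i x)
  lookup-difference i x = begin
    lookup (difference i) x
      ≡⟨ lookup-zipWith _⊕_ x (tabulate (σ i)) (vneg p (tabulate (σ i ∘ τ i))) ⟩
    lookup (tabulate (σ i)) x ⊕ lookup (vneg p (tabulate (σ i ∘ τ i))) x
      ≡⟨ cong₂ _⊕_ (lookup∘tabulate (σ i) x) (lookup-map x ⊖_ (tabulate (σ i ∘ τ i))) ⟩
    σ i x ⊕ ⊖ lookup (tabulate (σ i ∘ τ i)) x
      ≡⟨ cong (λ y → σ i x ⊕ ⊖ y) (lookup∘tabulate (σ i ∘ τ i) x) ⟩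
    σ i x ⊕ ⊖ σ i (τ i x)
      ∎
    where open ≡-Reasoning

  tail-difference : ∀ i → tail (difference i) ≡ unit i
  tail-difference i = lookup-extensionality entry
    where
    open ≡-Reasoning
    entry : ∀ l → lookup (difference i) (suc l) ≡ lookup (unit i) l
    entry l with l ≟ i
    ... | yes refl = begin
      lookup (difference i) (suc i)
        ≡⟨ lookup-difference i (suc i) ⟩
      σ i (suc i) ⊕ ⊖ σ i (τ i (suc i))
        ≡⟨ cong₂ (λ a b → a ⊕ ⊖ σ i b) (transpose-matchʳ (suc zero) (suc i)) (transpose-matchʳ zero (suc i)) ⟩
      suc zero ⊕ ⊖ σ i zero
        ≡⟨ cong (λ b → suc zero ⊕ ⊖ b) (transpose-other {i = suc zero} {suc i} {zero} (λ ()) (λ ())) ⟩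
      suc zero ⊕ ⊖ zero
        ≡⟨ cong (suc zero ⊕_) ⊖-zero ⟩
      suc zero ⊕ zero
        ≡⟨ ⊕-identityʳ (suc zero) ⟩
      suc zero
        ≡⟨ lookup∘update i (vzero p) (suc zero) ⟨
      lookup (unit i) i
        ∎
    ... | no l≢i = begin
      lookup (difference i) (suc l)
        ≡⟨ lookup-difference i (suc l) ⟩
      σ i (suc l) ⊕ ⊖ σ i (τ i (suc l))
        ≡⟨ cong (λ b → σ i (suc l) ⊕ ⊖ σ i b) (transpose-other {i = zero} {suc i} {suc l} (λ ()) (l≢i ∘ suc-injective)) ⟩
      σ i (suc l) ⊕ ⊖ σ i (suc l)
        ≡⟨ ⊕-inverseʳ (σ i (suc l)) ⟩
      zero
        ≡⟨ lookup-replicate l zero ⟨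
      lookup (vzero p) l
        ≡⟨ lookup∘update′ l≢i (vzero p) (suc zero) ⟨
      lookup (unit i) l
        ∎

  module _ (zeroSum-gen : ∀ {g : Vec (Fin p) p} → AllDistinct g → ZeroSum g) where

    -- The head of difference i is never computed: being in F̄, it is forced by the zero sum.
    ψ-unit : ∀ i → ψ (unit i) ≡ difference i
    ψ-unit i = subst (λ t → ψ t ≡ difference i) (tail-difference i)
                 (ψ∘tail (difference i) (InFbar⇒zeroSum zeroSum-gen (difference∈F̄ i)))

    ψ∈F̄ : ∀ t → InFbar p (ψ t)
    ψ∈F̄ = unit-induction (InFbar p ∘ ψ)
            (subst (InFbar p) (sym ψ-vzero) zero)
            (λ {u} {v} ψu∈F̄ ψv∈F̄ → subst (InFbar p) (sym (ψ-vadd u v)) (add ψu∈F̄ ψv∈F̄))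
            (λ i → subst (InFbar p) (sym (ψ-unit i)) (difference∈F̄ i))

    zeroSumGenerators⇒iso : LinearIsoOntoFbar p (suc n)
    zeroSumGenerators⇒iso = record
      { ψ         = ψ
      ; additive  = ψ-vadd
      ; homog     = ψ-vscale
      ; injective = ψ-injective
      ; into      = ψ∈F̄
      ; onto      = λ g g∈F̄ → tail g , ψ∘tail g (InFbar⇒zeroSum zeroSum-gen g∈F̄)
      }

proposition3p3 : (p : ℕ) .{{_ : NonZero p}} → Prime p → 3 ≤ p → LinearIsoOntoFbar p (p ∸ 1)
proposition3p3 (suc (suc n)) p-prime 3≤p@(s≤s (s≤s (s≤s z≤n))) =
  Generators.zeroSumGenerators⇒iso n (allDistinct⇒zeroSum (prime⇒odd p-prime 3≤p))
  where open VectorSpace (suc (suc n))
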